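{- Let $P$ be a finite bounded poset with a left modular maximal chain $M$. Suppose $y\le w\le z$ in $P$ and $x\in M$. Then $((x\wedge z)\vee^z y)\vee^z w$ is well-defined and equals $(x\wedge z)\vee^z w$. Similarly, $((x\vee y)\wedge_y z)\wedge_y w$ is well-defined and equals $(x\vee y)\wedge_y w$.
   Context: A poset is bounded if it has unique minimum $\hat0$ and maximum $\hat1$. $x\vee y$, $x\wedge y$ denote least common upper bound / greatest common lower bound when they exist. For $w,z\ge y$, $w\wedge_y z$ is the greatest element of $\{u: y\le u\le w,\ u\le z\}$ if it exists (then it is called well-defined); for $w,y\le z$, $w\vee^z y$ is the least element of $\{u: w,y\le u\le z\}$ if it exists. An element $x$ is viable if for all $y\le z$ both $(x\vee y)\wedge_y z$ and $(x\wedge z)\vee^z y$ exist; a viable $x$ is left modular if $(x\vee y)\wedge_y z=(x\wedge z)\vee^z y$ for all $y\le z$. A maximal chain is left modular if all its elements are viable and left modular. -}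

module Defs where

open import Data.Nat using (ℕ)
open import Data.Fin using (Fin)
open import Data.Product using (Σ; ∃; ∃-syntax; _×_)
open import Relation.Binary.PropositionalEquality using (_≡_)
open import Relation.Binary.Structures using (IsPartialOrder)
open import Data.Sum using (_⊎_)

record FinPoset : Set₁ where
  field
    n        : ℕ
    _≤_      : Fin n → Fin n → Set
    isPO     : IsPartialOrder _≡_ _≤_

module _ (P : FinPoset) where
  open FinPoset P

  Bounded : Set
  Bounded = (∃[ b ] ∀ u → b ≤ u) × (∃[ t ] ∀ u → u ≤ t)

  IsJoin : Fin n → Fin n → Fin n → Set
  IsJoin x y u = x ≤ u × y ≤ u × (∀ v → x ≤ v → y ≤ v → u ≤ v)

  IsMeet : Fin n → Fin n → Fin n → Set
  IsMeet x y u = u ≤ x × u ≤ y × (∀ v → v ≤ x → v ≤ y → v ≤ u)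

  -- u = w ∧_y z : greatest element of {u : y ≤ u ≤ w, u ≤ z}
  IsRelMeet : Fin n → Fin n → Fin n → Fin n → Set
  IsRelMeet y w z u =
    (y ≤ u × u ≤ w × u ≤ z) × (∀ v → y ≤ v → v ≤ w → v ≤ z → v ≤ u)

  -- u = w ∨^z y : least element of {u : w ≤ u, y ≤ u, u ≤ z}
  IsRelJoin : Fin n → Fin n → Fin n → Fin n → Set
  IsRelJoin w y z u =
    (w ≤ u × y ≤ u × u ≤ z) × (∀ v → w ≤ v → y ≤ v → v ≤ z → u ≤ v)

  Viable : Fin n → Set
  Viable x = ∀ y z → y ≤ z →
    (∃[ j ] ∃[ m ] (IsJoin x y j × IsRelMeet y j z m)) ×
    (∃[ k ] ∃[ m ] (IsMeet x z k × IsRelJoin k y z m))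

  LeftModular : Fin n → Set
  LeftModular x = Viable x × (∀ y z → y ≤ z →
    ∀ j m k m′ → IsJoin x y j → IsRelMeet y j z m →
                 IsMeet x z k → IsRelJoin k y z m′ → m ≡ m′)

  IsChain : (Fin n → Set) → Set
  IsChain M = ∀ a b → M a → M b → (a ≤ b ⊎ b ≤ a)

  IsMaximalChain : (Fin n → Set) → Set
  IsMaximalChain M =
    IsChain M × (∀ c → (∀ a → M a → (a ≤ c ⊎ c ≤ a)) → M c)

  LeftModularChain : (Fin n → Set) → Set
  LeftModularChain M = IsMaximalChain M × (∀ x → M x → LeftModular x)

{-# OPTIONS --safe #-}
module Submission where

-- Only the viability of x matters: the relative joins a ∨^z y and a ∨^z w
-- (with a = x ∧ z) exist by viability, and whenever y ≤ w the second absorbs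
-- the first, since a ∨^z w is itself an upper bound of a and y below z.
-- The meet half is the order dual.

open import Defs
open import Data.Fin using (Fin)
open import Data.Product using (∃-syntax; _×_; _,_; proj₁; proj₂)
open import Relation.Binary.PropositionalEquality using (_≡_; subst)
open import Relation.Binary.Structures using (IsPartialOrder)

module _ (P : FinPoset) where
  open FinPoset P
  open IsPartialOrder isPO using (antisym; trans)

  private
    variable
      a b c d j m x y w z : Fin n

  IsMeet-unique : IsMeet P x z a → IsMeet P x z b → a ≡ b
  IsMeet-unique (a≤x , a≤z , a-greatest) (b≤x , b≤z , b-greatest) =
    antisym (b-greatest _ a≤x a≤z) (a-greatest _ b≤x b≤z)

  IsJoin-unique : IsJoin P x y a → IsJoin P x y b → a ≡ b
  IsJoin-unique (x≤a , y≤a , a-least) (x≤b , y≤b , b-least) =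
    antisym (a-least _ x≤b y≤b) (b-least _ x≤a y≤a)

  IsRelJoin-absorb : y ≤ w → IsRelJoin P a y z b → IsRelJoin P a w z c →
                     IsRelJoin P b w z c
  IsRelJoin-absorb y≤w ((a≤b , _ , _) , b-least) ((a≤c , w≤c , c≤z) , c-least) =
    (b≤c , w≤c , c≤z) , λ v b≤v w≤v v≤z → c-least v (trans a≤b b≤v) w≤v v≤z
    where
    b≤c = b-least _ a≤c (trans y≤w w≤c) c≤z

  IsRelMeet-absorb : w ≤ z → IsRelMeet P y j z m → IsRelMeet P y j w d →
                     IsRelMeet P y m w d
  IsRelMeet-absorb w≤z ((_ , m≤j , _) , m-greatest) ((y≤d , d≤j , d≤w) , d-greatest) =
    (y≤d , d≤m , d≤w) , λ v y≤v v≤m v≤w → d-greatest v y≤v (trans v≤m m≤j) v≤w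
    where
    d≤m = m-greatest _ y≤d d≤j (trans d≤w w≤z)

  viable-relJoin-absorb : Viable P x → y ≤ w → w ≤ z →
    ∃[ a ] ∃[ b ] ∃[ c ]
      (IsMeet P x z a × IsRelJoin P a y z b ×
       IsRelJoin P b w z c × IsRelJoin P a w z c)
  viable-relJoin-absorb {y = y} {w} {z} viable y≤w w≤z
    with proj₂ (viable y z (trans y≤w w≤z)) | proj₂ (viable w z w≤z)
  ... | a , b , x∧z , b-join | a′ , c , x∧z′ , c-join′ =
    a , b , c , x∧z , b-join , IsRelJoin-absorb y≤w b-join c-join , c-join
    where
    c-join = subst (λ u → IsRelJoin P u w z c) (IsMeet-unique x∧z′ x∧z) c-join′

  viable-relMeet-absorb : Viable P x → y ≤ w → w ≤ z →
    ∃[ j ] ∃[ m ] ∃[ d ]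
      (IsJoin P x y j × IsRelMeet P y j z m ×
       IsRelMeet P y m w d × IsRelMeet P y j w d)
  viable-relMeet-absorb {y = y} {w} {z} viable y≤w w≤z
    with proj₁ (viable y z (trans y≤w w≤z)) | proj₁ (viable y w y≤w)
  ... | j , m , x∨y , m-meet | j′ , d , x∨y′ , d-meet′ =
    j , m , d , x∨y , m-meet , IsRelMeet-absorb w≤z m-meet d-meet , d-meet
    where
    d-meet = subst (λ u → IsRelMeet P y u w d) (IsJoin-unique x∨y′ x∨y) d-meet′

lemma2 : (P : FinPoset) → Bounded P → (M : Fin (FinPoset.n P) → Set) →
    LeftModularChain P M →
    ∀ x y w z → FinPoset._≤_ P y w → FinPoset._≤_ P w z → M x →
    (∃[ a ] ∃[ b ] ∃[ c ]
       (IsMeet P x z a × IsRelJoin P a y z b ×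
        IsRelJoin P b w z c × IsRelJoin P a w z c))
    ×
    (∃[ j ] ∃[ m ] ∃[ d ]
       (IsJoin P x y j × IsRelMeet P y j z m ×
        IsRelMeet P y m w d × IsRelMeet P y j w d))
lemma2 P _ M (_ , leftModular) x y w z y≤w w≤z x∈M =
  viable-relJoin-absorb P viable y≤w w≤z , viable-relMeet-absorb P viable y≤w w≤z
  where
  viable : Viable P x
  viable = proj₁ (leftModular x x∈M)
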